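{- Let $m,n$ be positive integers with $n\geq 2m+1$, let $W_n^m$ be the web graph on $n$ vertices with parameter $m$, and let $k$ be a positive integer with $k\leq 2m+1$. Then $$\gamma_{\times k}(W_n^m)=\left\lceil \frac{kn}{2m+1}\right\rceil .$$
   Context: Web graph: for positive integers $m\geq 1$ and $n\geq 2m+1$, $W_n^m$ has vertex set $\{v_1,\dots,v_n\}$, and $v_iv_j$ is an edge if and only if $j\equiv i\pm l \pmod n$ for some $l\in\{1,\dots,m\}$. Every closed neighborhood has exactly $2m+1$ vertices. For a graph $G$, the closed neighborhood of $v$ is $N_G[v]=\{v\}\cup\{u: uv\in E(G)\}$. For a non-negative integer $k$, a set $D\subseteq V(G)$ is a $k$-tuple dominating set of $G$ if $|N_G[v]\cap D|\geq k$ for every $v\in V(G)$. The $k$-tuple domination number $\gamma_{\times k}(G)$ is the minimum cardinality of a $k$-tuple dominating set of $G$ (and $+\infty$ if none exists, i.e. if $k>\delta(G)+1$). -}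

module Defs where

open import Data.Nat using (ℕ; zero; suc; _+_; _*_; _≤_; _≥_; _%_; NonZero)
open import Data.Nat.Properties using (_≟_)
open import Data.Fin using (Fin; toℕ)
open import Data.Fin.Subset using (Subset; _∩_; ∣_∣)
open import Data.Vec using (tabulate)
open import Data.Product using (Σ; ∃; _×_; _,_)
open import Data.Sum using (_⊎_)
open import Relation.Binary.PropositionalEquality using (_≡_)
open import Relation.Nullary using (Dec; does; ¬_)
open import Relation.Nullary.Decidable using (_⊎-dec_; _×-dec_; ¬?)
open import Data.Fin.Properties using (any?)

-- Web graph W_n^m on vertex set Fin n (v_1..v_n ↦ 0..n-1).
-- v_i v_j is an edge iff j ≡ i ± l (mod n) for some l ∈ {1,…,m}.
-- l ranges over Fin m, representing l = suc (toℕ l') ∈ {1,…,m}.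
-- j ≡ i + l (mod n):  j % n ≡ (i + l) % n
-- j ≡ i - l (mod n):  (j + l) % n ≡ i % n
webEdge : (n m : ℕ) → .{{NonZero n}} → Fin n → Fin n → Set
webEdge n m i j =
  ∃ λ (l' : Fin m) →
    (toℕ j % n ≡ (toℕ i + suc (toℕ l')) % n)
    ⊎ ((toℕ j + suc (toℕ l')) % n ≡ toℕ i % n)

webEdge? : (n m : ℕ) → .{{_ : NonZero n}} → (i j : Fin n) → Dec (webEdge n m i j)
webEdge? n m i j = any? λ l' →
  (toℕ j % n ≟ (toℕ i + suc (toℕ l')) % n)
  ⊎-dec ((toℕ j + suc (toℕ l')) % n ≟ toℕ i % n)

closedNbhd : (n m : ℕ) → .{{_ : NonZero n}} → Fin n → Subset n
closedNbhd n m v = tabulate λ u →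
  does ((toℕ u ≟ toℕ v) ⊎-dec webEdge? n m v u)

IsKTupleDom : (n m : ℕ) → .{{_ : NonZero n}} → ℕ → Subset n → Set
IsKTupleDom n m k D = ∀ (v : Fin n) → ∣ closedNbhd n m v ∩ D ∣ ≥ k

KTupleDomNumberIs : (n m : ℕ) → .{{_ : NonZero n}} → ℕ → ℕ → Set
KTupleDomNumberIs n m k c =
  (Σ (Subset n) λ D → IsKTupleDom n m k D × ∣ D ∣ ≡ c)
  × (∀ (D : Subset n) → IsKTupleDom n m k D → c ≤ ∣ D ∣)

-- Read modulo n, the closed neighbourhood of v is a window of 2m + 1 consecutive vertices.
-- Summing |N[v] ∩ D| over all v counts each element of D exactly 2m + 1 times, so a k-tuple
-- dominating set has kn ≤ (2m + 1)|D|. Conversely, for c = ⌈kn / (2m + 1)⌉ ≤ n, the c points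
-- i < n at which ⌊ic / n⌋ increases meet every window of length 2m + 1 in
-- ⌊(a + 2m + 1)c / n⌋ - ⌊ac / n⌋ ≥ k points, by telescoping.
module Submission where

open import Defs
open import Data.Bool using (Bool; true; false; _∧_)
open import Data.Empty using (⊥-elim)
open import Data.Fin using (Fin; toℕ; fromℕ<)
open import Data.Fin.Properties using (toℕ<n; toℕ-fromℕ<)
open import Data.Fin.Subset using (Subset; _∩_; ∣_∣)
open import Data.Nat
open import Data.Nat.DivMod
open import Data.Nat.Divisibility using (divides)
open import Data.Nat.Properties
open import Data.Nat.Tactic.RingSolver using (solve-∀)
open import Data.Product using (_,_)
open import Data.Sum using (_⊎_; inj₁; inj₂)
open import Data.Vec using ([]; _∷_; tabulate)
open import Relation.Binary.Definitions using (tri<; tri≈; tri>)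
open import Relation.Binary.PropositionalEquality
open import Relation.Nullary using (Dec; yes; no; does)
open import Relation.Nullary.Decidable using (dec-true; dec-false; _⊎-dec_)

∑ : ℕ → (ℕ → ℕ) → ℕ
∑ zero    f = 0
∑ (suc n) f = f 0 + ∑ n (λ i → f (suc i))

∑-cong : ∀ n {f g : ℕ → ℕ} → (∀ i → i < n → f i ≡ g i) → ∑ n f ≡ ∑ n g
∑-cong zero    f≗g = refl
∑-cong (suc n) f≗g = cong₂ _+_ (f≗g 0 z<s) (∑-cong n (λ i i<n → f≗g (suc i) (s<s i<n)))

∑-const : ∀ n c → ∑ n (λ _ → c) ≡ n * c
∑-const zero    c = refl
∑-const (suc n) c = cong (c +_) (∑-const n c)

∑-snoc : ∀ n f → ∑ (suc n) f ≡ ∑ n f + f n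
∑-snoc zero    f = +-comm (f 0) 0
∑-snoc (suc n) f = begin
  f 0 + ∑ (suc n) (λ i → f (suc i))    ≡⟨ cong (f 0 +_) (∑-snoc n (λ i → f (suc i))) ⟩
  f 0 + (∑ n (λ i → f (suc i)) + f (suc n)) ≡⟨ +-assoc (f 0) _ _ ⟨
  f 0 + ∑ n (λ i → f (suc i)) + f (suc n) ∎
  where open ≡-Reasoning

∑-distrib-+ : ∀ n f g → ∑ n (λ i → f i + g i) ≡ ∑ n f + ∑ n g
∑-distrib-+ zero    f g = refl
∑-distrib-+ (suc n) f g =
  trans (cong (f 0 + g 0 +_) (∑-distrib-+ n _ _)) (interchange (f 0) (g 0) _ _)
  where
  interchange : ∀ a b c d → a + b + (c + d) ≡ a + c + (b + d)
  interchange = solve-∀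

∑-comm : ∀ m n (f : ℕ → ℕ → ℕ) → ∑ m (λ i → ∑ n (f i)) ≡ ∑ n (λ j → ∑ m (λ i → f i j))
∑-comm zero    n f = sym (trans (∑-const n 0) (*-zeroʳ n))
∑-comm (suc m) n f = trans (cong (∑ n (f 0) +_) (∑-comm m n (λ i → f (suc i))))
                           (sym (∑-distrib-+ n (f 0) _))

∑-++ : ∀ a b f → ∑ (a + b) f ≡ ∑ a f + ∑ b (λ i → f (a + i))
∑-++ zero    b f = refl
∑-++ (suc a) b f =
  trans (cong (f 0 +_) (∑-++ a b (λ i → f (suc i)))) (sym (+-assoc (f 0) _ _))

∑-support : ∀ {L n} f → L ≤ n → (∀ i → L ≤ i → i < n → f i ≡ 0) → ∑ n f ≡ ∑ L f
∑-support {L} {n} f L≤n vanish = begin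
  ∑ n f                                   ≡⟨ cong (λ N → ∑ N f) (m+[n∸m]≡n L≤n) ⟨
  ∑ (L + (n ∸ L)) f                       ≡⟨ ∑-++ L (n ∸ L) f ⟩
  ∑ L f + ∑ (n ∸ L) (λ i → f (L + i))     ≡⟨ cong (∑ L f +_) tail≡0 ⟩
  ∑ L f + 0                               ≡⟨ +-identityʳ _ ⟩
  ∑ L f ∎
  where
  open ≡-Reasoning
  tail≡0 : ∑ (n ∸ L) (λ i → f (L + i)) ≡ 0
  tail≡0 = begin
    ∑ (n ∸ L) (λ i → f (L + i))  ≡⟨ ∑-cong (n ∸ L) (λ i i<n∸L →
                                      vanish (L + i) (m≤m+n L i)
                                        (subst (L + i <_) (m+[n∸m]≡n L≤n) (+-monoʳ-< L i<n∸L))) ⟩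
    ∑ (n ∸ L) (λ _ → 0)          ≡⟨ ∑-const (n ∸ L) 0 ⟩
    (n ∸ L) * 0                  ≡⟨ *-zeroʳ (n ∸ L) ⟩
    0 ∎

∑-≥ : ∀ n {k} f → (∀ i → i < n → k ≤ f i) → n * k ≤ ∑ n f
∑-≥ zero    f k≤f = z≤n
∑-≥ (suc n) f k≤f =
  +-mono-≤ (k≤f 0 z<s) (∑-≥ n (λ i → f (suc i)) (λ i i<n → k≤f (suc i) (s<s i<n)))

∑-rotate : ∀ n f → (∀ x → f (x + n) ≡ f x) → ∀ s → ∑ n (λ t → f (s + t)) ≡ ∑ n f
∑-rotate n f periodic zero    = refl
∑-rotate n f periodic (suc s) = begin
  ∑ n (λ t → f (suc s + t))  ≡⟨ ∑-cong n (λ t _ → cong f (sym (+-suc s t))) ⟩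
  ∑ n (λ t → f (s + suc t))  ≡⟨ shift (λ t → f (s + t)) wraps ⟩
  ∑ n (λ t → f (s + t))      ≡⟨ ∑-rotate n f periodic s ⟩
  ∑ n f ∎
  where
  open ≡-Reasoning
  wraps : f (s + n) ≡ f (s + 0)
  wraps = trans (periodic s) (cong f (sym (+-identityʳ s)))
  shift : ∀ g → g n ≡ g 0 → ∑ n (λ t → g (suc t)) ≡ ∑ n g
  shift g gn≡g0 = +-cancelˡ-≡ (g 0) _ _ (begin
    g 0 + ∑ n (λ t → g (suc t))  ≡⟨ ∑-snoc n g ⟩
    ∑ n g + g n                  ≡⟨ cong (∑ n g +_) gn≡g0 ⟩
    ∑ n g + g 0                  ≡⟨ +-comm (∑ n g) (g 0) ⟩
    g 0 + ∑ n g ∎)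

Δ : (ℕ → ℕ) → ℕ → ℕ
Δ F x = F (suc x) ∸ F x

∑-telescope : ∀ F → (∀ x → F x ≤ F (suc x)) → ∀ a N → ∑ N (λ t → Δ F (a + t)) + F a ≡ F (a + N)
∑-telescope F mono a zero    = cong F (sym (+-identityʳ a))
∑-telescope F mono a (suc N) = begin
  ∑ (suc N) (λ t → Δ F (a + t)) + F a          ≡⟨ cong (_+ F a) (∑-snoc N _) ⟩
  ∑ N (λ t → Δ F (a + t)) + Δ F (a + N) + F a   ≡⟨ swap (∑ N _) (Δ F (a + N)) (F a) ⟩
  ∑ N (λ t → Δ F (a + t)) + F a + Δ F (a + N)   ≡⟨ cong (_+ Δ F (a + N)) (∑-telescope F mono a N) ⟩
  F (a + N) + Δ F (a + N)                       ≡⟨ m+[n∸m]≡n (mono (a + N)) ⟩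
  F (suc (a + N))                               ≡⟨ cong F (+-suc a N) ⟨
  F (a + suc N) ∎
  where
  open ≡-Reasoning
  swap : ∀ x y z → x + y + z ≡ x + z + y
  swap = solve-∀

-- ⌈ a / L ⌉ for L = suc b is (a + b) / L.
⌈/⌉-least : ∀ a b d → a ≤ d * suc b → (a + b) / suc b ≤ d
⌈/⌉-least a b d a≤dL = <⇒≤pred (m<n*o⇒m/o<n {n = suc d}
  (subst (a + b <_) (+-comm (d * suc b) (suc b)) (+-mono-≤-< a≤dL (n<1+n b))))

⌈/⌉-upper : ∀ a b → a ≤ (a + b) / suc b * suc b
⌈/⌉-upper a b = +-cancelʳ-≤ b a q (begin
  a + b                          ≡⟨ m≡m%n+[m/n]*n (a + b) (suc b) ⟩
  (a + b) % suc b + q            ≤⟨ +-monoˡ-≤ q (s≤s⁻¹ (m%n<n (a + b) (suc b))) ⟩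
  b + q                          ≡⟨ +-comm b q ⟩
  q + b ∎)
  where
  open ≤-Reasoning
  q = (a + b) / suc b * suc b

𝟙 : Bool → ℕ
𝟙 true  = 1
𝟙 false = 0

𝟙-∧ : ∀ a b → 𝟙 (a ∧ b) ≡ 𝟙 a * 𝟙 b
𝟙-∧ true  true  = refl
𝟙-∧ true  false = refl
𝟙-∧ false b     = refl

indicator : ∀ {n} → Subset n → ℕ → ℕ
indicator []      _       = 0
indicator (x ∷ p) zero    = 𝟙 x
indicator (x ∷ p) (suc i) = indicator p i

∣p∣≡∑indicator : ∀ {n} (p : Subset n) → ∣ p ∣ ≡ ∑ n (indicator p)
∣p∣≡∑indicator []          = refl
∣p∣≡∑indicator (true ∷ p)  = cong suc (∣p∣≡∑indicator p)
∣p∣≡∑indicator (false ∷ p) = ∣p∣≡∑indicator p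

indicator-∩ : ∀ {n} (p q : Subset n) i → indicator (p ∩ q) i ≡ indicator p i * indicator q i
indicator-∩ []      []      i       = refl
indicator-∩ (x ∷ p) (y ∷ q) zero    = 𝟙-∧ x y
indicator-∩ (x ∷ p) (y ∷ q) (suc i) = indicator-∩ p q i

indicator-tabulate : ∀ {n} (g : Fin n → Bool) {i} (i<n : i < n) →
                     indicator (tabulate g) i ≡ 𝟙 (g (fromℕ< i<n))
indicator-tabulate {suc n} g {zero}  i<n = refl
indicator-tabulate {suc n} g {suc i} i<n = indicator-tabulate (λ j → g (Fin.suc j)) (s<s⁻¹ i<n)

module Congruence (n : ℕ) .{{_ : NonZero n}} where

  infix 4 _≋_
  _≋_ : ℕ → ℕ → Set
  a ≋ b = a % n ≡ b % n

  ≋-+ʳ : ∀ {a b} c → a ≋ b → a + c ≋ b + c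
  ≋-+ʳ {a} {b} c a≋b = begin
    (a + c) % n               ≡⟨ %-distribˡ-+ a c n ⟩
    (a % n + c % n) % n       ≡⟨ cong (λ x → (x + c % n) % n) a≋b ⟩
    (b % n + c % n) % n       ≡⟨ %-distribˡ-+ b c n ⟨
    (b + c) % n ∎
    where open ≡-Reasoning

  -- Adding c * (n - 1) turns the extra summand c into a multiple of n.
  ≋-cancelʳ : ∀ {a b} c → a + c ≋ b + c → a ≋ b
  ≋-cancelʳ {a} {b} c a+c≋b+c = begin
    a % n                     ≡⟨ absorb a ⟨
    (a + c + c * pred n) % n  ≡⟨ ≋-+ʳ (c * pred n) a+c≋b+c ⟩
    (b + c + c * pred n) % n  ≡⟨ absorb b ⟩
    b % n ∎
    where
    open ≡-Reasoning
    regroup : ∀ x c p → x + c + c * p ≡ x + c * suc p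
    regroup = solve-∀
    absorb : ∀ x → (x + c + c * pred n) % n ≡ x % n
    absorb x = trans (cong (_% n) (trans (regroup x c (pred n)) (cong (λ y → x + c * y) (suc-pred n))))
                     ([m+kn]%n≡m%n x c n)

  ≋-cancelˡ : ∀ {a b} c → c + a ≋ c + b → a ≋ b
  ≋-cancelˡ {a} {b} c c+a≋c+b =
    ≋-cancelʳ c (trans (cong (_% n) (+-comm a c)) (trans c+a≋c+b (cong (_% n) (+-comm c b))))

  ≋⇒≡ : ∀ {a b} → a < n → b < n → a ≋ b → a ≡ b
  ≋⇒≡ a<n b<n a≋b = trans (sym (m<n⇒m%n≡m a<n)) (trans a≋b (m<n⇒m%n≡m b<n))

  ≋⇒≡⊎≡+n : ∀ {a b} → a < n + n → b < n → a ≋ b → a ≡ b ⊎ a ≡ b + n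
  ≋⇒≡⊎≡+n {a} {b} a<2n b<n a≋b with a <? n
  ... | yes a<n = inj₁ (≋⇒≡ a<n b<n a≋b)
  ... | no  a≮n = inj₂ (trans (sym (m∸n+n≡m n≤a)) (cong (_+ n) a∸n≡b))
    where
    n≤a : n ≤ a
    n≤a = ≮⇒≥ a≮n
    a∸n<n : a ∸ n < n
    a∸n<n = +-cancelʳ-< n (a ∸ n) n (subst (_< n + n) (sym (m∸n+n≡m n≤a)) a<2n)
    a∸n≡b : a ∸ n ≡ b
    a∸n≡b = ≋⇒≡ a∸n<n b<n (trans (m≤n⇒[n∸m]%m≡n%m n≤a) a≋b)

  vertexAt : ℕ → Fin n
  vertexAt x = fromℕ< (m%n<n x n)

  vertexAt-≋ : ∀ x → toℕ (vertexAt x) ≋ x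
  vertexAt-≋ x = trans (cong (_% n) (toℕ-fromℕ< (m%n<n x n))) (m%n%n≡m%n x n)

  χ : Subset n → ℕ → ℕ
  χ D x = indicator D (x % n)

  χ-periodic : ∀ D x → χ D (x + n) ≡ χ D x
  χ-periodic D x = cong (indicator D) ([m+n]%n≡m%n x n)

  χ-tabulate : ∀ (g : Fin n → Bool) x → χ (tabulate g) x ≡ 𝟙 (g (vertexAt x))
  χ-tabulate g x = indicator-tabulate g (m%n<n x n)

  χ-∩ : ∀ D E x → χ (D ∩ E) x ≡ χ D x * χ E x
  χ-∩ D E x = indicator-∩ D E (x % n)

  ∑χ≡∣∣ : ∀ D → ∑ n (χ D) ≡ ∣ D ∣
  ∑χ≡∣∣ D = trans (∑-cong n (λ i i<n → cong (indicator D) (m<n⇒m%n≡m i<n)))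
                  (sym (∣p∣≡∑indicator D))

module WebNeighbourhood (n m : ℕ) .{{_ : NonZero n}} (2m+1≤n : 2 * m + 1 ≤ n) where

  open Congruence n

  m+m<n : m + m < n
  m+m<n = subst (_≤ n) (shape m) 2m+1≤n
    where
    shape : ∀ m → 2 * m + 1 ≡ suc (m + m)
    shape = solve-∀

  m<n : m < n
  m<n = ≤-<-trans (m≤m+n m m) m+m<n

  m+m≡2m : m + m ≡ 2 * m
  m+m≡2m = cong (m +_) (sym (+-identityʳ m))

  -- The window N[v] starts at v - m, written v + (n - m) to avoid truncated subtraction.
  windowStart : ℕ → ℕ
  windowStart w = w + (n ∸ m)

  w≋windowStart+m : ∀ w → w ≋ windowStart w + m
  w≋windowStart+m w = sym (trans (cong (_% n) windowStart+m≡w+n) ([m+n]%n≡m%n w n))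
    where
    windowStart+m≡w+n : windowStart w + m ≡ w + n
    windowStart+m≡w+n = trans (+-assoc w (n ∸ m) m) (cong (w +_) (m∸n+n≡m (<⇒≤ m<n)))

  InNbhd : Fin n → Fin n → Set
  InNbhd v u = toℕ u ≡ toℕ v ⊎ webEdge n m v u

  edgeForward : ∀ {v u} l → l < m → toℕ u ≋ toℕ v + suc l → webEdge n m v u
  edgeForward {v} {u} l l<m u≋v+l =
    fromℕ< l<m , inj₁ (subst (λ j → toℕ u ≋ toℕ v + suc j) (sym (toℕ-fromℕ< l<m)) u≋v+l)

  edgeBackward : ∀ {v u} l → l < m → toℕ u + suc l ≋ toℕ v → webEdge n m v u
  edgeBackward {v} {u} l l<m u+l≋v =
    fromℕ< l<m , inj₂ (subst (λ j → toℕ u + suc j ≋ toℕ v) (sym (toℕ-fromℕ< l<m)) u+l≋v)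

  inNbhd⇒ : ∀ v u t → t < n → toℕ u ≋ windowStart (toℕ v) + t → InNbhd v u → t ≤ 2 * m
  inNbhd⇒ v u t t<n u≋s+t (inj₁ u≡v) = subst (_≤ 2 * m) (sym t≡m) (m≤m+n m (m + 0))
    where
    t≡m : t ≡ m
    t≡m = ≋⇒≡ t<n m<n (≋-cancelˡ (windowStart (toℕ v))
            (trans (sym u≋s+t) (trans (cong (_% n) u≡v) (w≋windowStart+m (toℕ v)))))
  inNbhd⇒ v u t t<n u≋s+t (inj₂ (l , inj₁ u≋v+l)) =
    subst (_≤ 2 * m) (sym t≡m+l) (subst (m + suc (toℕ l) ≤_) m+m≡2m (+-monoʳ-≤ m (toℕ<n l)))
    where
    s = windowStart (toℕ v)
    v+l≋s+[m+l] : toℕ v + suc (toℕ l) ≋ s + (m + suc (toℕ l))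
    v+l≋s+[m+l] = trans (≋-+ʳ (suc (toℕ l)) (w≋windowStart+m (toℕ v))) (cong (_% n) (+-assoc s m _))
    t≡m+l : t ≡ m + suc (toℕ l)
    t≡m+l = ≋⇒≡ t<n (≤-<-trans (+-monoʳ-≤ m (toℕ<n l)) m+m<n)
              (≋-cancelˡ s (trans (sym u≋s+t) (trans u≋v+l v+l≋s+[m+l])))
  inNbhd⇒ v u t t<n u≋s+t (inj₂ (l , inj₂ u+l≋v))
    with ≋⇒≡⊎≡+n (+-mono-<-≤ t<n (≤-trans (toℕ<n l) (<⇒≤ m<n))) m<n t+l≋m
    where
    s = windowStart (toℕ v)
    t+l≋m : t + suc (toℕ l) ≋ m
    t+l≋m = ≋-cancelˡ s (begin
      (s + (t + suc (toℕ l))) % n  ≡⟨ cong (_% n) (+-assoc s t _) ⟨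
      (s + t + suc (toℕ l)) % n    ≡⟨ ≋-+ʳ (suc (toℕ l)) u≋s+t ⟨
      (toℕ u + suc (toℕ l)) % n    ≡⟨ trans u+l≋v (w≋windowStart+m (toℕ v)) ⟩
      (s + m) % n ∎)
      where open ≡-Reasoning
  ... | inj₁ t+l≡m = ≤-trans (≤-trans (m≤m+n t _) (≤-reflexive t+l≡m)) (m≤m+n m (m + 0))
  ... | inj₂ t+l≡m+n = ⊥-elim (<-irrefl (trans t+l≡m+n (+-comm m n)) t+l<n+m)
    where
    t+l<n+m : t + suc (toℕ l) < n + m
    t+l<n+m = +-mono-<-≤ t<n (toℕ<n l)

  inNbhd⇐ : ∀ v u t → toℕ u ≋ windowStart (toℕ v) + t → t ≤ 2 * m → InNbhd v u
  inNbhd⇐ v u t u≋s+t t≤2m with <-cmp t m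
  ... | tri≈ _ t≡m _ = inj₁ (≋⇒≡ (toℕ<n u) (toℕ<n v) (begin
      toℕ u % n                     ≡⟨ u≋s+t ⟩
      (windowStart (toℕ v) + t) % n ≡⟨ cong (λ j → (windowStart (toℕ v) + j) % n) t≡m ⟩
      (windowStart (toℕ v) + m) % n ≡⟨ w≋windowStart+m (toℕ v) ⟨
      toℕ v % n ∎))
    where open ≡-Reasoning
  ... | tri> _ _ m<t = inj₂ (edgeForward l l<m (begin
      toℕ u % n                       ≡⟨ u≋s+t ⟩
      (s + t) % n                     ≡⟨ cong (λ j → (s + j) % n) m+1+l≡t ⟨
      (s + (suc m + l)) % n           ≡⟨ cong (_% n) (regroup s m l) ⟩
      (s + m + suc l) % n             ≡⟨ ≋-+ʳ (suc l) (w≋windowStart+m (toℕ v)) ⟨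
      (toℕ v + suc l) % n ∎))
    where
    open ≡-Reasoning
    s = windowStart (toℕ v)
    l = t ∸ suc m
    m+1+l≡t : suc m + l ≡ t
    m+1+l≡t = m+[n∸m]≡n m<t
    l<m : l < m
    l<m = +-cancelˡ-< m l m (subst₂ _≤_ (sym m+1+l≡t) (sym m+m≡2m) t≤2m)
    regroup : ∀ s m l → s + (suc m + l) ≡ s + m + suc l
    regroup = solve-∀
  ... | tri< t<m _ _ = inj₂ (edgeBackward l l<m (begin
      (toℕ u + suc l) % n             ≡⟨ ≋-+ʳ (suc l) u≋s+t ⟩
      (s + t + suc l) % n             ≡⟨ cong (_% n) (regroup s t l) ⟩
      (s + (suc t + l)) % n           ≡⟨ cong (λ j → (s + j) % n) t+1+l≡m ⟩
      (s + m) % n                     ≡⟨ w≋windowStart+m (toℕ v) ⟨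
      toℕ v % n ∎))
    where
    open ≡-Reasoning
    s = windowStart (toℕ v)
    l = m ∸ suc t
    t+1+l≡m : suc t + l ≡ m
    t+1+l≡m = m+[n∸m]≡n t<m
    l<m : l < m
    l<m = subst (l <_) t+1+l≡m (m<n+m l z<s)
    regroup : ∀ s t l → s + t + suc l ≡ s + (suc t + l)
    regroup = solve-∀

  χ-nbhd-inside : ∀ v t → t ≤ 2 * m → χ (closedNbhd n m v) (windowStart (toℕ v) + t) ≡ 1
  χ-nbhd-inside v t t≤2m = trans (χ-tabulate _ (windowStart (toℕ v) + t))
    (cong 𝟙 (dec-true ((toℕ u ≟ toℕ v) ⊎-dec webEdge? n m v u) (inNbhd⇐ v u t (vertexAt-≋ _) t≤2m)))
    where
    u = vertexAt (windowStart (toℕ v) + t)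

  χ-nbhd-outside : ∀ v t → 2 * m < t → t < n → χ (closedNbhd n m v) (windowStart (toℕ v) + t) ≡ 0
  χ-nbhd-outside v t 2m<t t<n = trans (χ-tabulate _ (windowStart (toℕ v) + t))
    (cong 𝟙 (dec-false ((toℕ u ≟ toℕ v) ⊎-dec webEdge? n m v u)
      (λ u∈N[v] → <⇒≱ 2m<t (inNbhd⇒ v u t t<n (vertexAt-≋ _) u∈N[v]))))
    where
    u = vertexAt (windowStart (toℕ v) + t)

  L≤n : suc (2 * m) ≤ n
  L≤n = subst (_≤ n) (+-comm (2 * m) 1) 2m+1≤n

  ∣nbhd∩∣≡window : ∀ D v →
    ∣ closedNbhd n m v ∩ D ∣ ≡ ∑ (suc (2 * m)) (λ t → χ D (windowStart (toℕ v) + t))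
  ∣nbhd∩∣≡window D v = begin
    ∣ N ∩ D ∣                               ≡⟨ ∑χ≡∣∣ (N ∩ D) ⟨
    ∑ n (χ (N ∩ D))                         ≡⟨ ∑-rotate n (χ (N ∩ D)) (χ-periodic (N ∩ D)) s ⟨
    ∑ n (λ t → χ (N ∩ D) (s + t))           ≡⟨ ∑-cong n (λ t _ → χ-∩ N D (s + t)) ⟩
    ∑ n (λ t → χ N (s + t) * χ D (s + t))   ≡⟨ ∑-support _ L≤n outside ⟩
    ∑ L (λ t → χ N (s + t) * χ D (s + t))   ≡⟨ ∑-cong L inside ⟩
    ∑ L (λ t → χ D (s + t)) ∎
    where
    open ≡-Reasoning
    N = closedNbhd n m v
    s = windowStart (toℕ v)
    L = suc (2 * m)
    outside : ∀ t → L ≤ t → t < n → χ N (s + t) * χ D (s + t) ≡ 0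
    outside t L≤t t<n = cong (_* χ D (s + t)) (χ-nbhd-outside v t L≤t t<n)
    inside : ∀ t → t < L → χ N (s + t) * χ D (s + t) ≡ χ D (s + t)
    inside t t<L = trans (cong (_* χ D (s + t)) (χ-nbhd-inside v t (s≤s⁻¹ t<L))) (*-identityˡ _)

  -- Double counting: every vertex lies in exactly 2m + 1 windows.
  ∑windows≡ : ∀ D → ∑ n (λ w → ∑ (suc (2 * m)) (λ t → χ D (windowStart w + t))) ≡ suc (2 * m) * ∣ D ∣
  ∑windows≡ D = begin
    ∑ n (λ w → ∑ L (λ t → χ D (windowStart w + t)))   ≡⟨ ∑-comm n L (λ w t → χ D (windowStart w + t)) ⟩
    ∑ L (λ t → ∑ n (λ w → χ D (windowStart w + t)))   ≡⟨ ∑-cong L (λ t _ → column t) ⟩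
    ∑ L (λ _ → ∣ D ∣)                           ≡⟨ ∑-const L ∣ D ∣ ⟩
    L * ∣ D ∣ ∎
    where
    open ≡-Reasoning
    L = suc (2 * m)
    regroup : ∀ w r t → w + r + t ≡ r + t + w
    regroup = solve-∀
    column : ∀ t → ∑ n (λ w → χ D (windowStart w + t)) ≡ ∣ D ∣
    column t = begin
      ∑ n (λ w → χ D (windowStart w + t))         ≡⟨ ∑-cong n (λ w _ → cong (χ D) (regroup w (n ∸ m) t)) ⟩
      ∑ n (λ w → χ D (n ∸ m + t + w))       ≡⟨ ∑-rotate n (χ D) (χ-periodic D) (n ∸ m + t) ⟩
      ∑ n (χ D)                             ≡⟨ ∑χ≡∣∣ D ⟩
      ∣ D ∣ ∎

  lowerBound : ∀ {k} D → IsKTupleDom n m k D → (k * n + 2 * m) / suc (2 * m) ≤ ∣ D ∣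
  lowerBound {k} D dominating = ⌈/⌉-least (k * n) (2 * m) ∣ D ∣ (begin
    k * n                                              ≡⟨ *-comm k n ⟩
    n * k                                              ≤⟨ ∑-≥ n _ k≤window ⟩
    ∑ n (λ w → ∑ (suc (2 * m)) (λ t → χ D (windowStart w + t)))  ≡⟨ ∑windows≡ D ⟩
    suc (2 * m) * ∣ D ∣                                ≡⟨ *-comm (suc (2 * m)) ∣ D ∣ ⟩
    ∣ D ∣ * suc (2 * m) ∎)
    where
    open ≤-Reasoning
    k≤window : ∀ w → w < n → k ≤ ∑ (suc (2 * m)) (λ t → χ D (windowStart w + t))
    k≤window w w<n = subst (λ x → k ≤ ∑ (suc (2 * m)) (λ t → χ D (windowStart x + t))) (toℕ-fromℕ< w<n)
      (subst (k ≤_) (∣nbhd∩∣≡window D v) (dominating v))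
      where
      v = fromℕ< w<n

module Staircase (n c : ℕ) .{{_ : NonZero n}} (c≤n : c ≤ n) where

  open Congruence n

  stairs : ℕ → ℕ
  stairs x = x * c / n

  stairs-mono : ∀ x → stairs x ≤ stairs (suc x)
  stairs-mono x = /-monoˡ-≤ n (*-monoˡ-≤ c (n≤1+n x))

  stairs-step : ∀ x → stairs (suc x) ≤ suc (stairs x)
  stairs-step x = <⇒≤pred (m<n*o⇒m/o<n {suc x * c} {suc (suc (stairs x))} (begin-strict
    c + x * c                          ≡⟨ cong (c +_) (m≡m%n+[m/n]*n (x * c) n) ⟩
    c + (x * c % n + stairs x * n)     <⟨ +-mono-≤-< c≤n (+-monoˡ-< (stairs x * n) (m%n<n (x * c) n)) ⟩
    n + (n + stairs x * n)             ∎))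
    where open ≤-Reasoning

  stairs-periodic : ∀ y q → stairs (y + q * n) ≡ stairs y + q * c
  stairs-periodic y q = begin
    (y + q * n) * c / n        ≡⟨ cong (_/ n) (expand y q c n) ⟩
    (y * c + q * c * n) / n    ≡⟨ +-distrib-/-∣ʳ (y * c) (divides (q * c) refl) ⟩
    stairs y + q * c * n / n   ≡⟨ cong (stairs y +_) (m*n/n≡m (q * c) n) ⟩
    stairs y + q * c ∎
    where
    open ≡-Reasoning
    expand : ∀ y q c n → (y + q * n) * c ≡ y * c + q * c * n
    expand = solve-∀

  stairs-gap : ∀ a b k → k * n ≤ b * c → stairs a + k ≤ stairs (a + b)
  stairs-gap a b k kn≤bc = begin
    stairs a + k                 ≡⟨ m*n/n≡m (stairs a + k) n ⟨
    (stairs a + k) * n / n       ≤⟨ /-monoˡ-≤ n (begin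
      (stairs a + k) * n         ≡⟨ *-distribʳ-+ n (stairs a) k ⟩
      stairs a * n + k * n       ≤⟨ +-mono-≤ (m/n*n≤m (a * c) n) kn≤bc ⟩
      a * c + b * c              ≡⟨ *-distribʳ-+ c a b ⟨
      (a + b) * c ∎) ⟩
    stairs (a + b) ∎
    where open ≤-Reasoning

  jump : ℕ → ℕ
  jump = Δ stairs

  jump-periodic : ∀ y q → jump (y + q * n) ≡ jump y
  jump-periodic y q = begin
    jump (y + q * n)                                    ≡⟨ cong₂ _∸_ (stairs-periodic (suc y) q) (stairs-periodic y q) ⟩
    (stairs (suc y) + q * c) ∸ (stairs y + q * c)       ≡⟨ cong₂ _∸_ (+-comm _ (q * c)) (+-comm _ (q * c)) ⟩
    (q * c + stairs (suc y)) ∸ (q * c + stairs y)       ≡⟨ [m+n]∸[m+o]≡n∸o (q * c) _ _ ⟩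
    jump y ∎
    where open ≡-Reasoning

  jump-% : ∀ x → jump (x % n) ≡ jump x
  jump-% x = trans (sym (jump-periodic (x % n) (x / n))) (cong jump (sym (m≡m%n+[m/n]*n x n)))

  jumpsAt : Subset n
  jumpsAt = tabulate (λ i → does (stairs (toℕ i) <? stairs (suc (toℕ i))))

  𝟙-jumps? : ∀ x → 𝟙 (does (stairs x <? stairs (suc x))) ≡ jump x
  𝟙-jumps? x = byCases (stairs x <? stairs (suc x))
    where
    byCases : (up? : Dec (stairs x < stairs (suc x))) → 𝟙 (does up?) ≡ jump x
    byCases (yes up)   = sym (trans (cong (_∸ stairs x) (≤-antisym (stairs-step x) up)) (m+n∸n≡m 1 (stairs x)))
    byCases (no  flat) = sym (trans (cong (_∸ stairs x) (≤-antisym (≮⇒≥ flat) (stairs-mono x))) (n∸n≡0 (stairs x)))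

  χ-jumpsAt : ∀ x → χ jumpsAt x ≡ jump x
  χ-jumpsAt x = begin
    χ jumpsAt x                                             ≡⟨ χ-tabulate _ x ⟩
    𝟙 (does (stairs (toℕ i) <? stairs (suc (toℕ i))))       ≡⟨ cong (λ j → 𝟙 (does (stairs j <? stairs (suc j)))) (toℕ-fromℕ< (m%n<n x n)) ⟩
    𝟙 (does (stairs (x % n) <? stairs (suc (x % n))))       ≡⟨ 𝟙-jumps? (x % n) ⟩
    jump (x % n)                                            ≡⟨ jump-% x ⟩
    jump x ∎
    where
    open ≡-Reasoning
    i = vertexAt x

  ∣jumpsAt∣≡c : ∣ jumpsAt ∣ ≡ c
  ∣jumpsAt∣≡c = begin
    ∣ jumpsAt ∣                  ≡⟨ ∑χ≡∣∣ jumpsAt ⟨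
    ∑ n (χ jumpsAt)              ≡⟨ ∑-cong n (λ x _ → χ-jumpsAt x) ⟩
    ∑ n jump                     ≡⟨ +-identityʳ _ ⟨
    ∑ n jump + 0                 ≡⟨ cong (∑ n jump +_) (0/n≡0 n) ⟨
    ∑ n jump + stairs 0          ≡⟨ ∑-telescope stairs stairs-mono 0 n ⟩
    n * c / n                    ≡⟨ cong (_/ n) (*-comm n c) ⟩
    c * n / n                    ≡⟨ m*n/n≡m c n ⟩
    c ∎
    where open ≡-Reasoning

  window-jumpsAt : ∀ a b k → k * n ≤ b * c → k ≤ ∑ b (λ t → χ jumpsAt (a + t))
  window-jumpsAt a b k kn≤bc = +-cancelʳ-≤ (stairs a) k _ (begin
    k + stairs a                                      ≡⟨ +-comm k (stairs a) ⟩
    stairs a + k                                      ≤⟨ stairs-gap a b k kn≤bc ⟩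
    stairs (a + b)                                    ≡⟨ ∑-telescope stairs stairs-mono a b ⟨
    ∑ b (λ t → jump (a + t)) + stairs a               ≡⟨ cong (_+ stairs a) (∑-cong b (λ t _ → χ-jumpsAt (a + t))) ⟨
    ∑ b (λ t → χ jumpsAt (a + t)) + stairs a ∎)
    where open ≤-Reasoning

theorem6p8 : (m n k : ℕ) → 1 ≤ m → 2 * m + 1 ≤ n → 1 ≤ k → k ≤ 2 * m + 1 →
    .{{_ : NonZero n}} →
    KTupleDomNumberIs n m k ((k * n + 2 * m) / suc (2 * m))
theorem6p8 m n k _ 2m+1≤n _ k≤2m+1 = (jumpsAt , dominating , ∣jumpsAt∣≡c) , lowerBound
  where
  open WebNeighbourhood n m 2m+1≤n
  L = suc (2 * m)
  c = (k * n + 2 * m) / L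
  c≤n : c ≤ n
  c≤n = ⌈/⌉-least (k * n) (2 * m) n
          (subst (k * n ≤_) (*-comm L n) (*-monoˡ-≤ n (subst (k ≤_) (+-comm (2 * m) 1) k≤2m+1)))
  open Staircase n c c≤n
  dominating : IsKTupleDom n m k jumpsAt
  dominating v = subst (k ≤_) (sym (∣nbhd∩∣≡window jumpsAt v))
    (window-jumpsAt (windowStart (toℕ v)) L k (subst (k * n ≤_) (*-comm c L) (⌈/⌉-upper (k * n) (2 * m))))
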